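{- For all integers $1\le k\le d$, the coefficient of $t$ in the Ehrhart polynomial of the hypersimplex $\Delta_{k,d+1}$ is positive.
   Context: The hypersimplex $\Delta_{k,d+1}\subset\mathbb R^{d+1}$ is the convex hull of all vectors in $\{0,1\}^{d+1}$ with exactly $k$ coordinates equal to $1$. Its Ehrhart polynomial is the polynomial $\mathrm{Lat}(\Delta_{k,d+1},t)=|t\Delta_{k,d+1}\cap\mathbb Z^{d+1}|$, $t\in\mathbb N$. -}

module Defs where

open import Data.Nat using (ℕ; zero; suc; _*_; _≟_)
open import Data.List using (List; []; _∷_; map; concatMap; filter; length; upTo)
open import Data.Vec using (Vec; []; _∷_)
import Data.Vec as Vec
open import Data.Rational using (ℚ; 0ℚ)
open import Relation.Binary.PropositionalEquality using (_≡_)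
import Data.Rational as ℚ
import Data.Integer as ℤ

fromℕ : ℕ → ℚ
fromℕ n = ℤ.+ n ℚ./ 1

cube : (n t : ℕ) → List (Vec ℕ n)
cube zero    t = [] ∷ []
cube (suc n) t = concatMap (λ j → map (j ∷_) (cube n t)) (upTo (suc t))

-- Hypersimplex Δ_{k,d+1} = { x ∈ [0,1]^{d+1} : x_1 + ... + x_{d+1} = k }
-- (= conv of 0/1-vectors with exactly k ones), so its t-th dilate is
-- t Δ_{k,d+1} = { x ∈ [0,t]^{d+1} : Σ x_i = k t }.
hypersimplexLat : (k d t : ℕ) → ℕ
hypersimplexLat k d t =
  length (filter (λ v → Vec.sum v ≟ k * t) (cube (suc d) t))

-- Univariate polynomials over ℚ as coefficient lists [c₀, c₁, c₂, ...].
Poly : Set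
Poly = List ℚ

eval : Poly → ℚ → ℚ
eval []       x = 0ℚ
eval (c ∷ cs) x = c ℚ.+ x ℚ.* eval cs x

coeff : Poly → ℕ → ℚ
coeff []       i       = 0ℚ
coeff (c ∷ cs) zero    = c
coeff (c ∷ cs) (suc i) = coeff cs i

IsEhrhartPolyHypersimplex : ℕ → ℕ → Poly → Set
IsEhrhartPolyHypersimplex k d P =
  (t : ℕ) → eval P (fromℕ t) ≡ fromℕ (hypersimplexLat k d t)

{-# OPTIONS --safe #-}
module Submission where

-- Write R d y = (y+1)(y+2)⋯(y+d) (`rising`), so that R d y = d! · C(y+d, d) for y ≥ −d.
-- Inclusion–exclusion over the coordinates exceeding t (proved here by induction on the
-- dimension, through a telescoping sum of weak-composition counts) gives, for 1 ≤ k ≤ d + 1,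
--
--   d! · Lat(Δ_{k,d+1}, t) = Σ_{j<k} (−1)^j C(d+1, j) R d ((k−j) t − j),
--
-- an integer polynomial in t. A rational polynomial is determined by its values on ℕ, so every
-- Ehrhart polynomial has linear coefficient 1/d! · Σ_{j<k} (−1)^j C(d+1, j) (k−j) R′ d (−j).
-- The j = 0 term is k · Σ_{1≤i≤d} d!/i. For j ≥ 1 the factor y + j is the only one of R d that
-- vanishes at −j, so R′ d (−j) = (−1)^(j−1) (j−1)! (d−j)!, and the j-th term is
-- −(k−j) C(d+1, j) (j−1)! (d−j)! ≥ −k · d!/j because k ≤ d + 1. As k ≤ d, the summand k · d!/d
-- is not cancelled, so the coefficient is positive.

open import Defs
open import Data.Nat using (ℕ; _≤_)
open import Data.Product using (Σ; _×_)
open import Data.Rational using (0ℚ; _<_)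

module IntegerSums where

  open import Data.Nat as ℕ using (zero; suc)
  import Data.Nat.Properties as ℕP
  open import Data.Nat.Combinatorics using (_C_; nCk+nC[k+1]≡[n+1]C[k+1]; k>n⇒nCk≡0)
  open import Data.Integer as ℤ using (ℤ; +_; 0ℤ; -1ℤ; _+_; _-_; _*_; -_; _^_)
  import Data.Integer.Properties as ℤP
  open import Data.Integer.Tactic.RingSolver using (solve-∀)
  open import Data.Sum using (inj₁; inj₂)
  open import Relation.Binary.PropositionalEquality

  ∑ : ℕ → (ℕ → ℤ) → ℤ
  ∑ zero    f = 0ℤ
  ∑ (suc n) f = ∑ n f + f n

  ∑-cong : ∀ n {f g : ℕ → ℤ} → (∀ j → j ℕ.< n → f j ≡ g j) → ∑ n f ≡ ∑ n g
  ∑-cong zero    f≡g = refl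
  ∑-cong (suc n) f≡g =
    cong₂ _+_ (∑-cong n (λ j j<n → f≡g j (ℕP.m<n⇒m<1+n j<n))) (f≡g n (ℕP.n<1+n n))

  ∑-head : ∀ n f → ∑ (suc n) f ≡ f 0 + ∑ n (λ j → f (suc j))
  ∑-head zero    f = ℤP.+-comm 0ℤ (f 0)
  ∑-head (suc n) f = trans (cong (_+ f (suc n)) (∑-head n f)) (ℤP.+-assoc (f 0) _ _)

  ∑-distrib-+ : ∀ n f g → ∑ n (λ j → f j + g j) ≡ ∑ n f + ∑ n g
  ∑-distrib-+ zero    f g = refl
  ∑-distrib-+ (suc n) f g =
    trans (cong (_+ (f n + g n)) (∑-distrib-+ n f g)) (interchange (∑ n f) (∑ n g) (f n) (g n))
    where
    interchange : ∀ a b c d → a + b + (c + d) ≡ a + c + (b + d)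
    interchange = solve-∀

  ∑-neg : ∀ n f → ∑ n (λ j → - f j) ≡ - ∑ n f
  ∑-neg zero    f = refl
  ∑-neg (suc n) f = trans (cong (_+ - f n) (∑-neg n f)) (sym (ℤP.neg-distrib-+ (∑ n f) (f n)))

  ∑-distrib-- : ∀ n f g → ∑ n (λ j → f j - g j) ≡ ∑ n f - ∑ n g
  ∑-distrib-- n f g = trans (∑-distrib-+ n f (λ j → - g j)) (cong (λ s → ∑ n f + s) (∑-neg n g))

  *-distribˡ-∑ : ∀ n c f → c * ∑ n f ≡ ∑ n (λ j → c * f j)
  *-distribˡ-∑ zero    c f = ℤP.*-zeroʳ c
  *-distribˡ-∑ (suc n) c f =
    trans (ℤP.*-distribˡ-+ c (∑ n f) (f n)) (cong (_+ c * f n) (*-distribˡ-∑ n c f))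

  ∑-swap : ∀ m n (f : ℕ → ℕ → ℤ) → ∑ m (λ i → ∑ n (f i)) ≡ ∑ n (λ j → ∑ m (λ i → f i j))
  ∑-swap zero    n f = sym (∑-zero n)
    where
    ∑-zero : ∀ n → ∑ n (λ _ → 0ℤ) ≡ 0ℤ
    ∑-zero zero    = refl
    ∑-zero (suc n) = trans (ℤP.+-identityʳ _) (∑-zero n)
  ∑-swap (suc m) n f = trans (cong (_+ ∑ n (f m)) (∑-swap m n f))
                             (sym (∑-distrib-+ n (λ j → ∑ m (λ i → f i j)) (f m)))

  ∑-telescope : ∀ (h f : ℤ → ℤ) → (∀ y → h y ≡ h (y - + 1) + f y) →
                ∀ n y → ∑ n (λ i → f (y - + i)) ≡ h y - h (y - + n)
  ∑-telescope h f step zero    y =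
    sym (trans (cong (λ z → h y - h z) (ℤP.+-identityʳ y)) (ℤP.+-inverseʳ (h y)))
  ∑-telescope h f step (suc n) y = begin
    ∑ n (λ i → f (y - + i)) + f (y - + n)                   ≡⟨ cong (_+ f (y - + n)) (∑-telescope h f step n y) ⟩
    h y - h (y - + n) + f (y - + n)                         ≡⟨ cong (λ z → h y - z + f (y - + n)) (step (y - + n)) ⟩
    h y - (h (y - + n - + 1) + f (y - + n)) + f (y - + n)   ≡⟨ cancel (h y) (h (y - + n - + 1)) (f (y - + n)) ⟩
    h y - h (y - + n - + 1)                                 ≡⟨ cong (λ z → h y - h z) (shift y (+ n)) ⟩
    h y - h (y - + suc n)                                   ∎
    where
    open ≡-Reasoning
    cancel : ∀ a b c → a - (b + c) + c ≡ a - b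
    cancel = solve-∀
    shift : ∀ y n → y - n - + 1 ≡ y - (+ 1 + n)
    shift = solve-∀

  ∑-truncate : ∀ {m} n f → m ℕ.≤ n → (∀ j → m ℕ.≤ j → f j ≡ 0ℤ) → ∑ n f ≡ ∑ m f
  ∑-truncate         zero    f ℕ.z≤n _ = refl
  ∑-truncate {m} (suc n) f m≤1+n vanish with ℕP.m≤n⇒m<n∨m≡n m≤1+n
  ... | inj₂ refl  = refl
  ... | inj₁ m<1+n = begin
    ∑ n f + f n   ≡⟨ cong₂ _+_ (∑-truncate n f m≤n vanish) (vanish n m≤n) ⟩
    ∑ m f + 0ℤ    ≡⟨ ℤP.+-identityʳ _ ⟩
    ∑ m f         ∎
    where
    open ≡-Reasoning
    m≤n : m ℕ.≤ n
    m≤n = ℕP.≤-pred m<1+n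

  ∑-mono-≤ : ∀ n {f g} → (∀ j → j ℕ.< n → f j ℤ.≤ g j) → ∑ n f ℤ.≤ ∑ n g
  ∑-mono-≤ zero    f≤g = ℤP.≤-refl
  ∑-mono-≤ (suc n) f≤g =
    ℤP.+-mono-≤ (∑-mono-≤ n (λ j j<n → f≤g j (ℕP.m<n⇒m<1+n j<n))) (f≤g n (ℕP.n<1+n n))

  signedBinomial : ℕ → ℕ → ℤ
  signedBinomial n j = -1ℤ ^ j * + (n C j)

  signedBinomialSum : ℕ → (ℕ → ℤ) → ℤ
  signedBinomialSum n f = ∑ (suc n) (λ j → signedBinomial n j * f j)

  signedBinomial-pascal : ∀ n j →
    signedBinomial (suc n) (suc j) ≡ signedBinomial n (suc j) - signedBinomial n j
  signedBinomial-pascal n j = begin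
    -1ℤ * -1ℤ ^ j * + (suc n C suc j)                   ≡⟨ cong (λ c → -1ℤ * -1ℤ ^ j * + c) (sym (nCk+nC[k+1]≡[n+1]C[k+1] n j)) ⟩
    -1ℤ * -1ℤ ^ j * + (n C j ℕ.+ n C suc j)             ≡⟨ cong (λ c → -1ℤ * -1ℤ ^ j * c) (ℤP.pos-+ (n C j) (n C suc j)) ⟩
    -1ℤ * -1ℤ ^ j * (+ (n C j) + + (n C suc j))         ≡⟨ expand (-1ℤ ^ j) (+ (n C j)) (+ (n C suc j)) ⟩
    -1ℤ * -1ℤ ^ j * + (n C suc j) - -1ℤ ^ j * + (n C j) ∎
    where
    open ≡-Reasoning
    expand : ∀ s a b → -1ℤ * s * (a + b) ≡ -1ℤ * s * b - s * a
    expand = solve-∀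

  signedBinomialSum-cong : ∀ n {f g} → (∀ j → f j ≡ g j) → signedBinomialSum n f ≡ signedBinomialSum n g
  signedBinomialSum-cong n f≡g = ∑-cong (suc n) (λ j _ → cong (signedBinomial n j *_) (f≡g j))

  signedBinomialSum-suc : ∀ n f →
    signedBinomialSum (suc n) f ≡ signedBinomialSum n (λ j → f j - f (suc j))
  signedBinomialSum-suc n f = begin
    signedBinomialSum (suc n) f
      ≡⟨ ∑-head (suc n) _ ⟩
    a′ 0 * f 0 + ∑ (suc n) (λ j → a′ (suc j) * f (suc j))
      ≡⟨ cong (λ s → a 0 * f 0 + s) (∑-cong (suc n) (λ j _ → split j)) ⟩
    a 0 * f 0 + ∑ (suc n) (λ j → a (suc j) * f (suc j) - a j * f (suc j))
      ≡⟨ cong (λ s → a 0 * f 0 + s) (∑-distrib-- (suc n) _ _) ⟩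
    a 0 * f 0 + (∑ (suc n) (λ j → a (suc j) * f (suc j)) - B)
      ≡⟨ sym (ℤP.+-assoc (a 0 * f 0) _ _) ⟩
    a 0 * f 0 + ∑ (suc n) (λ j → a (suc j) * f (suc j)) - B
      ≡⟨ cong (_- B) (sym (∑-head (suc n) (λ j → a j * f j))) ⟩
    signedBinomialSum n f + a (suc n) * f (suc n) - B
      ≡⟨ cong (λ c → signedBinomialSum n f + c - B) top-vanishes ⟩
    signedBinomialSum n f + 0ℤ - B
      ≡⟨ cong (_- B) (ℤP.+-identityʳ (signedBinomialSum n f)) ⟩
    signedBinomialSum n f - B
      ≡⟨ sym (∑-distrib-- (suc n) _ _) ⟩
    ∑ (suc n) (λ j → a j * f j - a j * f (suc j))
      ≡⟨ ∑-cong (suc n) (λ j _ → factorˡ (a j) (f j) (f (suc j))) ⟩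
    signedBinomialSum n (λ j → f j - f (suc j)) ∎
    where
    open ≡-Reasoning
    a a′ : ℕ → ℤ
    a  = signedBinomial n
    a′ = signedBinomial (suc n)
    B : ℤ
    B = ∑ (suc n) (λ j → a j * f (suc j))
    factorʳ : ∀ x y z → (x - y) * z ≡ x * z - y * z
    factorʳ = solve-∀
    factorˡ : ∀ x y z → x * y - x * z ≡ x * (y - z)
    factorˡ = solve-∀
    split : ∀ j → a′ (suc j) * f (suc j) ≡ a (suc j) * f (suc j) - a j * f (suc j)
    split j = trans (cong (_* f (suc j)) (signedBinomial-pascal n j)) (factorʳ (a (suc j)) (a j) (f (suc j)))
    top-vanishes : a (suc n) * f (suc n) ≡ 0ℤ
    top-vanishes = trans (cong (λ c → -1ℤ ^ suc n * + c * f (suc n)) (k>n⇒nCk≡0 (ℕP.n<1+n n)))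
                         (cong (_* f (suc n)) (ℤP.*-zeroʳ (-1ℤ ^ suc n)))

  ∑-signedBinomialSum : ∀ m n (f : ℕ → ℕ → ℤ) →
    ∑ m (λ i → signedBinomialSum n (f i)) ≡ signedBinomialSum n (λ j → ∑ m (λ i → f i j))
  ∑-signedBinomialSum m n f = trans (∑-swap m (suc n) (λ i j → signedBinomial n j * f i j))
    (∑-cong (suc n) (λ j _ → sym (*-distribˡ-∑ m (signedBinomial n j) (λ i → f i j))))

module CubeSlices where

  open import Data.Nat as ℕ using (zero; suc)
  open import Data.Integer using (ℤ; +_; -[1+_]; 0ℤ; _+_; _-_; _*_)
  import Data.Integer as ℤ
  import Data.Integer.Properties as ℤP
  open import Data.Integer.Tactic.RingSolver using (solve-∀)
  open import Data.List using (List; []; _∷_; _++_; map; filter; length; concatMap; applyUpTo)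
  open import Data.List.Properties using (length-++; filter-++; filter-≐)
  open import Data.Vec using (Vec)
  import Data.Vec as Vec
  open import Data.Bool using (true; false)
  open import Data.Product using (_,_)
  open import Level using (0ℓ)
  open import Relation.Nullary using (does)
  open import Relation.Unary using (Pred; Decidable; _≐_)
  open import Relation.Binary.PropositionalEquality
  open IntegerSums

  module _ {B : Set} {P : Pred B 0ℓ} (P? : Decidable P) where

    length-filter-map : ∀ {A : Set} (g : A → B) xs →
      length (filter P? (map g xs)) ≡ length (filter (λ x → P? (g x)) xs)
    length-filter-map g []       = refl
    length-filter-map g (x ∷ xs) with does (P? (g x))
    ... | true  = cong suc (length-filter-map g xs)
    ... | false = length-filter-map g xs

    length-filter-concatMap : ∀ (h : ℕ → List B) n f →
      + length (filter P? (concatMap h (applyUpTo f n))) ≡ ∑ n (λ i → + length (filter P? (h (f i))))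
    length-filter-concatMap h zero    f = refl
    length-filter-concatMap h (suc n) f = begin
      + length (filter P? (h (f 0) ++ rest))
        ≡⟨ cong (λ xs → + length xs) (filter-++ P? (h (f 0)) rest) ⟩
      + length (filter P? (h (f 0)) ++ filter P? rest)
        ≡⟨ cong +_ (length-++ (filter P? (h (f 0)))) ⟩
      + length (filter P? (h (f 0))) + + length (filter P? rest)
        ≡⟨ cong (λ s → + length (filter P? (h (f 0))) + s) (length-filter-concatMap h n (λ i → f (suc i))) ⟩
      + length (filter P? (h (f 0))) + ∑ n (λ i → + length (filter P? (h (f (suc i)))))
        ≡⟨ sym (∑-head n _) ⟩
      ∑ (suc n) (λ i → + length (filter P? (h (f i)))) ∎
      where
      open ≡-Reasoning
      rest : List B
      rest = concatMap h (applyUpTo (λ i → f (suc i)) n)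

  sliceSize : ℕ → ℕ → ℤ → ℕ
  sliceSize n t s = length (filter (λ v → + Vec.sum v ℤ.≟ s) (cube n t))

  sliceSize-suc : ∀ n t s → + sliceSize (suc n) t s ≡ ∑ (suc t) (λ i → + sliceSize n t (s - + i))
  sliceSize-suc n t s =
    trans (length-filter-concatMap (λ v → + Vec.sum v ℤ.≟ s) (λ i → map (i Vec.∷_) (cube n t)) (suc t) (λ i → i))
          (∑-cong (suc t) (λ i _ → cong +_ (trans (length-filter-map _ (i Vec.∷_) (cube n t))
            (cong length (filter-≐ (λ v → + Vec.sum (i Vec.∷ v) ℤ.≟ s) (λ v → + Vec.sum v ℤ.≟ s - + i)
                                   (first-entry i) (cube n t))))))
    where
    first-entry : ∀ i → (λ (v : Vec ℕ n) → + (i ℕ.+ Vec.sum v) ≡ s) ≐ (λ v → + Vec.sum v ≡ s - + i)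
    first-entry i = (λ {v} eq → trans (cancel (+ i) (+ Vec.sum v)) (cong (_- + i) eq))
                  , (λ eq → trans (cong (λ z → + i + z) eq) (restore (+ i) s))
      where
      cancel : ∀ a b → b ≡ a + b - a
      cancel = solve-∀
      restore : ∀ a b → a + (b - a) ≡ b
      restore = solve-∀

  weakCompositions : ℕ → ℕ → ℕ
  weakCompositions zero    zero    = 1
  weakCompositions zero    (suc m) = 0
  weakCompositions (suc n) zero    = 1
  weakCompositions (suc n) (suc m) = weakCompositions (suc n) m ℕ.+ weakCompositions n (suc m)

  weakCompositionsℤ : ℕ → ℤ → ℤ
  weakCompositionsℤ n (+ m)    = + weakCompositions n m
  weakCompositionsℤ n -[1+ _ ] = 0ℤ

  weakCompositionsℤ-pascal : ∀ n y →
    weakCompositionsℤ (suc n) y ≡ weakCompositionsℤ (suc n) (y - + 1) + weakCompositionsℤ n y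
  weakCompositionsℤ-pascal zero    (+ zero)  = refl
  weakCompositionsℤ-pascal (suc n) (+ zero)  = refl
  weakCompositionsℤ-pascal n       (+ suc m) = refl
  weakCompositionsℤ-pascal n       -[1+ m ]  = refl

  weakCompositionsℤ-negative : ∀ n {y} → y ℤ.< 0ℤ → weakCompositionsℤ n y ≡ 0ℤ
  weakCompositionsℤ-negative n { -[1+ _ ]} _         = refl
  weakCompositionsℤ-negative n {+ _}      (ℤ.+<+ ())

  sliceSize-zero : ∀ t s → + sliceSize 0 t s ≡ weakCompositionsℤ 0 s
  sliceSize-zero t (+ zero)  = refl
  sliceSize-zero t (+ suc m) = refl
  sliceSize-zero t -[1+ m ]  = refl

  sliceSize-closedForm : ∀ n t s →
    + sliceSize n t s ≡ signedBinomialSum n (λ j → weakCompositionsℤ n (s - + (j ℕ.* suc t)))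
  sliceSize-closedForm zero    t s = begin
    + sliceSize 0 t s                                     ≡⟨ sliceSize-zero t s ⟩
    weakCompositionsℤ 0 s                                 ≡⟨ cong (weakCompositionsℤ 0) (sym (ℤP.+-identityʳ s)) ⟩
    weakCompositionsℤ 0 (s - + 0)                         ≡⟨ sym (ℤP.*-identityˡ _) ⟩
    signedBinomial 0 0 * weakCompositionsℤ 0 (s - + 0)    ≡⟨ sym (ℤP.+-identityˡ _) ⟩
    signedBinomialSum 0 (λ j → weakCompositionsℤ 0 (s - + (j ℕ.* suc t))) ∎
    where open ≡-Reasoning
  sliceSize-closedForm (suc n) t s = begin
    + sliceSize (suc n) t s
      ≡⟨ sliceSize-suc n t s ⟩
    ∑ T (λ i → + sliceSize n t (s - + i))
      ≡⟨ ∑-cong T (λ i _ → sliceSize-closedForm n t (s - + i)) ⟩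
    ∑ T (λ i → signedBinomialSum n (λ j → weakCompositionsℤ n (s - + i - + (j ℕ.* T))))
      ≡⟨ ∑-signedBinomialSum T n _ ⟩
    signedBinomialSum n (λ j → ∑ T (λ i → weakCompositionsℤ n (s - + i - + (j ℕ.* T))))
      ≡⟨ signedBinomialSum-cong n window ⟩
    signedBinomialSum n (λ j → F j - F (suc j))
      ≡⟨ sym (signedBinomialSum-suc n F) ⟩
    signedBinomialSum (suc n) F ∎
    where
    open ≡-Reasoning
    T : ℕ
    T = suc t
    F : ℕ → ℤ
    F j = weakCompositionsℤ (suc n) (s - + (j ℕ.* T))
    swap-subtrahends : ∀ s a b → s - a - b ≡ s - b - a
    swap-subtrahends = solve-∀
    merge-subtrahends : ∀ s a b → s - a - b ≡ s - (b + a)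
    merge-subtrahends = solve-∀
    window : ∀ j → ∑ T (λ i → weakCompositionsℤ n (s - + i - + (j ℕ.* T))) ≡ F j - F (suc j)
    window j = begin
      ∑ T (λ i → weakCompositionsℤ n (s - + i - + (j ℕ.* T)))
        ≡⟨ ∑-cong T (λ i _ → cong (weakCompositionsℤ n) (swap-subtrahends s (+ i) (+ (j ℕ.* T)))) ⟩
      ∑ T (λ i → weakCompositionsℤ n (s - + (j ℕ.* T) - + i))
        ≡⟨ ∑-telescope (weakCompositionsℤ (suc n)) (weakCompositionsℤ n) (weakCompositionsℤ-pascal n) T (s - + (j ℕ.* T)) ⟩
      F j - weakCompositionsℤ (suc n) (s - + (j ℕ.* T) - + T)
        ≡⟨ cong (λ y → F j - weakCompositionsℤ (suc n) y) (merge-subtrahends s (+ (j ℕ.* T)) (+ T)) ⟩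
      F j - F (suc j) ∎

module RisingFactorial where

  open import Data.Nat as ℕ using (zero; suc; _!; _∸_; _/_; s≤s)
  import Data.Nat.Properties as ℕP
  open import Data.Nat.DivMod using (*-/-assoc; m*n/n≡m)
  open import Data.Nat.Divisibility using (_∣_; ∣-trans; m∣m*n; m≤n⇒m!∣n!)
  open import Data.Integer as ℤ using (ℤ; +_; -[1+_]; 0ℤ; 1ℤ; -1ℤ; _+_; _*_; -_; _^_; -≤-)
  import Data.Integer.Properties as ℤP
  open import Data.Integer.Tactic.RingSolver using (solve-∀)
  open import Relation.Binary.PropositionalEquality
  open IntegerSums using (∑; ∑-cong; *-distribˡ-∑)
  open CubeSlices using (weakCompositions; weakCompositionsℤ)

  rising : ℕ → ℤ → ℤ
  rising zero    y = 1ℤ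
  rising (suc d) y = (1ℤ + y) * rising d (1ℤ + y)

  rising-suc-top : ∀ d y → rising (suc d) y ≡ rising d y * (y + + suc d)
  rising-suc-top zero    y = base y
    where
    base : ∀ y → (1ℤ + y) * 1ℤ ≡ 1ℤ * (y + 1ℤ)
    base = solve-∀
  rising-suc-top (suc d) y =
    trans (cong ((1ℤ + y) *_) (rising-suc-top d (1ℤ + y))) (regroup (1ℤ + y) (rising d (1ℤ + y)) y (+ suc d))
    where
    regroup : ∀ a r y n → a * (r * ((1ℤ + y) + n)) ≡ a * r * (y + (1ℤ + n))
    regroup = solve-∀

  weakCompositions-one : ∀ m → weakCompositions 1 m ≡ 1
  weakCompositions-one zero    = refl
  weakCompositions-one (suc m) = cong (ℕ._+ 0) (weakCompositions-one m)

  rising-nonneg : ∀ d m → rising d (+ m) ≡ + (d !) * + weakCompositions (suc d) m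
  rising-nonneg zero    m       = sym (trans (ℤP.*-identityˡ _) (cong +_ (weakCompositions-one m)))
  rising-nonneg (suc d) zero    = begin
    rising (suc d) (+ 0)                   ≡⟨ rising-suc-top d (+ 0) ⟩
    rising d (+ 0) * + suc d               ≡⟨ cong (_* + suc d) (rising-nonneg d 0) ⟩
    + (d !) * 1ℤ * + suc d                 ≡⟨ reorder (+ (d !)) (+ suc d) ⟩
    + suc d * + (d !) * 1ℤ                 ≡⟨ cong (_* 1ℤ) (sym (ℤP.pos-* (suc d) (d !))) ⟩
    + (suc d !) * 1ℤ                       ∎
    where
    open ≡-Reasoning
    reorder : ∀ a b → a * 1ℤ * b ≡ b * a * 1ℤ
    reorder = solve-∀
  rising-nonneg (suc d) (suc m) = begin
    rising (suc d) (+ suc m)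
      ≡⟨ rising-suc-top d (+ suc m) ⟩
    R * (+ suc m + + suc d)
      ≡⟨ split R (+ suc m) (+ suc d) ⟩
    + suc m * R + + suc d * R
      ≡⟨ cong (λ x → rising (suc d) (+ m) + + suc d * x) (rising-nonneg d (suc m)) ⟩
    rising (suc d) (+ m) + + suc d * (+ (d !) * W₁)
      ≡⟨ cong₂ _+_ (rising-nonneg (suc d) m)
                   (trans (sym (ℤP.*-assoc (+ suc d) (+ (d !)) W₁)) (cong (_* W₁) (sym (ℤP.pos-* (suc d) (d !))))) ⟩
    + (suc d !) * W₂ + + (suc d !) * W₁
      ≡⟨ sym (ℤP.*-distribˡ-+ (+ (suc d !)) W₂ W₁) ⟩
    + (suc d !) * + weakCompositions (suc (suc d)) (suc m) ∎
    where
    open ≡-Reasoning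
    R W₁ W₂ : ℤ
    R  = rising d (+ suc m)
    W₁ = + weakCompositions (suc d) (suc m)
    W₂ = + weakCompositions (suc (suc d)) m
    split : ∀ r a b → r * (a + b) ≡ a * r + b * r
    split = solve-∀

  rising-zero : ∀ d → rising d 0ℤ ≡ + (d !)
  rising-zero d = trans (rising-nonneg d 0) (ℤP.*-identityʳ (+ (d !)))

  rising-vanishes : ∀ d p → p ℕ.< d → rising d -[1+ p ] ≡ 0ℤ
  rising-vanishes (suc d) zero    _         = refl
  rising-vanishes (suc d) (suc p) (s≤s p<d) =
    trans (cong (-[1+ p ] *_) (rising-vanishes d p p<d)) (ℤP.*-zeroʳ -[1+ p ])

  rising-weakCompositionsℤ : ∀ d y → - + d ℤ.≤ y → rising d y ≡ + (d !) * weakCompositionsℤ (suc d) y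
  rising-weakCompositionsℤ d       (+ m)    _         = rising-nonneg d m
  rising-weakCompositionsℤ (suc d) -[1+ p ] (-≤- p≤d) =
    trans (rising-vanishes (suc d) p (s≤s p≤d)) (sym (ℤP.*-zeroʳ (+ (suc d !))))

  rising′ : ℕ → ℤ → ℤ
  rising′ zero    y = 0ℤ
  rising′ (suc d) y = rising d (1ℤ + y) + (1ℤ + y) * rising′ d (1ℤ + y)

  rising′-suc-top : ∀ d y → rising′ (suc d) y ≡ rising′ d y * (y + + suc d) + rising d y
  rising′-suc-top zero    y = base y
    where
    base : ∀ y → 1ℤ + (1ℤ + y) * 0ℤ ≡ 0ℤ * (y + 1ℤ) + 1ℤ
    base = solve-∀
  rising′-suc-top (suc d) y = begin
    rising (suc d) a + a * rising′ (suc d) a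
      ≡⟨ cong₂ (λ r r′ → r + a * r′) (rising-suc-top d a) (rising′-suc-top d a) ⟩
    R * (a + N) + a * (R′ * (a + N) + R)
      ≡⟨ product-rule R R′ y N ⟩
    (R + a * R′) * (y + (1ℤ + N)) + a * R ∎
    where
    open ≡-Reasoning
    a N R R′ : ℤ
    a  = 1ℤ + y
    N  = + suc d
    R  = rising d a
    R′ = rising′ d a
    product-rule : ∀ R R′ y N → R * ((1ℤ + y) + N) + (1ℤ + y) * (R′ * ((1ℤ + y) + N) + R)
                              ≡ (R + (1ℤ + y) * R′) * (y + (1ℤ + N)) + (1ℤ + y) * R
    product-rule = solve-∀

  rising′-root : ∀ {d J} → J ℕ.< d → rising′ d -[1+ J ] ≡ -1ℤ ^ J * + (J ! ℕ.* (d ∸ suc J) !)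
  rising′-root {suc d} {zero}  _         = begin
    rising d 0ℤ + 0ℤ        ≡⟨ ℤP.+-identityʳ _ ⟩
    rising d 0ℤ             ≡⟨ rising-zero d ⟩
    + (d !)                 ≡⟨ cong +_ (sym (ℕP.*-identityˡ (d !))) ⟩
    + (1 ℕ.* d !)           ≡⟨ sym (ℤP.*-identityˡ _) ⟩
    1ℤ * + (1 ℕ.* d !)      ∎
    where open ≡-Reasoning
  rising′-root {suc d} {suc J} (s≤s J<d) = begin
    rising d -[1+ J ] + -[1+ J ] * rising′ d -[1+ J ]
      ≡⟨ cong₂ (λ x y → x + -[1+ J ] * y) (rising-vanishes d J J<d) (rising′-root J<d) ⟩
    0ℤ + - + suc J * (-1ℤ ^ J * + (J ! ℕ.* R))
      ≡⟨ cong (λ x → 0ℤ + - + suc J * (-1ℤ ^ J * x)) (ℤP.pos-* (J !) R) ⟩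
    0ℤ + - + suc J * (-1ℤ ^ J * (+ (J !) * + R))
      ≡⟨ regroup (+ suc J) (-1ℤ ^ J) (+ (J !)) (+ R) ⟩
    -1ℤ * -1ℤ ^ J * (+ suc J * + (J !) * + R)
      ≡⟨ cong (λ x → -1ℤ * -1ℤ ^ J * (x * + R)) (sym (ℤP.pos-* (suc J) (J !))) ⟩
    -1ℤ * -1ℤ ^ J * (+ (suc J !) * + R)
      ≡⟨ cong (-1ℤ * -1ℤ ^ J *_) (sym (ℤP.pos-* (suc J !) R)) ⟩
    -1ℤ ^ suc J * + (suc J ! ℕ.* R) ∎
    where
    open ≡-Reasoning
    R : ℕ
    R = (d ∸ suc J) !
    regroup : ∀ n s a b → 0ℤ + - n * (s * (a * b)) ≡ -1ℤ * s * (n * a * b)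
    regroup = solve-∀

  1+J∣d! : ∀ {J d} → J ℕ.< d → suc J ∣ d !
  1+J∣d! {J} J<d = ∣-trans (m∣m*n (J !)) (m≤n⇒m!∣n! J<d)

  [1+n]!/[1+n]≡n! : ∀ n → suc n ! / suc n ≡ n !
  [1+n]!/[1+n]≡n! n = trans (cong (_/ suc n) (ℕP.*-comm (suc n) (n !))) (m*n/n≡m (n !) (suc n))

  rising′-zero : ∀ d → rising′ d 0ℤ ≡ ∑ d (λ J → + (d ! / suc J))
  rising′-zero zero    = refl
  rising′-zero (suc d) = begin
    rising′ (suc d) 0ℤ
      ≡⟨ rising′-suc-top d 0ℤ ⟩
    rising′ d 0ℤ * + suc d + rising d 0ℤ
      ≡⟨ cong₂ (λ x y → x * + suc d + y) (rising′-zero d) (rising-zero d) ⟩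
    ∑ d (λ J → + (d ! / suc J)) * + suc d + + (d !)
      ≡⟨ cong₂ _+_ scale (cong +_ (sym ([1+n]!/[1+n]≡n! d))) ⟩
    ∑ d (λ J → + (suc d ! / suc J)) + + (suc d ! / suc d) ∎
    where
    open ≡-Reasoning
    scale : ∑ d (λ J → + (d ! / suc J)) * + suc d ≡ ∑ d (λ J → + (suc d ! / suc J))
    scale = begin
      ∑ d (λ J → + (d ! / suc J)) * + suc d     ≡⟨ ℤP.*-comm _ (+ suc d) ⟩
      + suc d * ∑ d (λ J → + (d ! / suc J))     ≡⟨ *-distribˡ-∑ d (+ suc d) _ ⟩
      ∑ d (λ J → + suc d * + (d ! / suc J))     ≡⟨ ∑-cong d (λ J J<d → trans (sym (ℤP.pos-* (suc d) _))
                                                     (cong +_ (sym (*-/-assoc (suc d) (1+J∣d! J<d))))) ⟩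
      ∑ d (λ J → + (suc d ! / suc J))           ∎

module HypersimplexCount where

  open import Data.Nat as ℕ using (suc; _!; _∸_)
  import Data.Nat.Properties as ℕP
  open import Data.Integer as ℤ using (ℤ; +_; 0ℤ; 1ℤ; _+_; _-_; _*_; -_; +≤+; +<+)
  import Data.Integer.Properties as ℤP
  open import Data.Integer.Tactic.RingSolver using (solve-∀)
  open import Data.List using (length)
  open import Data.List.Properties using (filter-≐)
  import Data.Vec as Vec
  open import Data.Product using (_,_)
  open import Relation.Binary.PropositionalEquality
  open IntegerSums
  open CubeSlices
  open RisingFactorial

  hypersimplexLat≡sliceSize : ∀ k d t → hypersimplexLat k d t ≡ sliceSize (suc d) t (+ (k ℕ.* t))
  hypersimplexLat≡sliceSize k d t =
    cong length (filter-≐ (λ v → Vec.sum v ℕ.≟ k ℕ.* t) (λ v → + Vec.sum v ℤ.≟ + (k ℕ.* t))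
                          ((λ eq → cong +_ eq) , ℤP.+-injective) (cube (suc d) t))

  shiftedTarget : ∀ {j k} t → j ≤ k → + (k ℕ.* t) - + (j ℕ.* suc t) ≡ - + j + + (k ∸ j) * + t
  shiftedTarget {j} t j≤k with ℕP.m≤n⇒∃[o]m+o≡n j≤k
  ... | e , refl = begin
    + ((j ℕ.+ e) ℕ.* t) - + (j ℕ.* suc t)   ≡⟨ cong₂ _-_ (ℤP.pos-* (j ℕ.+ e) t) (ℤP.pos-* j (suc t)) ⟩
    (+ j + + e) * + t - + j * (1ℤ + + t)    ≡⟨ collect (+ j) (+ e) (+ t) ⟩
    - + j + + e * + t                        ≡⟨ cong (λ n → - + j + + n * + t) (sym (ℕP.m+n∸m≡n j e)) ⟩
    - + j + + (j ℕ.+ e ∸ j) * + t            ∎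
    where
    open ≡-Reasoning
    collect : ∀ j e t → (j + e) * t - j * (1ℤ + t) ≡ - j + e * t
    collect = solve-∀

  shiftedTarget-bound : ∀ {j k d} t → j ℕ.< k → k ≤ suc d → - + d ℤ.≤ - + j + + (k ∸ j) * + t
  shiftedTarget-bound {j} {k} t j<k k≤1+d =
    ℤP.≤-trans (ℤP.neg-mono-≤ (+≤+ (ℕP.≤-pred (ℕP.≤-trans j<k k≤1+d))))
               (ℤP.≤-trans (ℤP.i≤i+j (- + j) (+ ((k ∸ j) ℕ.* t)))
                           (ℤP.≤-reflexive (cong (λ z → - + j + z) (ℤP.pos-* (k ∸ j) t))))

  shiftedTarget-negative : ∀ {j k} t → 1 ≤ k → k ≤ j → + (k ℕ.* t) - + (j ℕ.* suc t) ℤ.< 0ℤ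
  shiftedTarget-negative {j} {k} t 1≤k k≤j =
    ℤP.<-≤-trans (ℤP.+-monoˡ-< (- + (j ℕ.* suc t)) (+<+ kt<j[1+t]))
                 (ℤP.≤-reflexive (ℤP.+-inverseʳ (+ (j ℕ.* suc t))))
    where
    kt<j[1+t] : k ℕ.* t ℕ.< j ℕ.* suc t
    kt<j[1+t] = ℕP.<-≤-trans (ℕP.m<n+m (k ℕ.* t) (ℕP.<-≤-trans 1≤k k≤j))
                             (ℕP.≤-trans (ℕP.+-monoʳ-≤ j (ℕP.*-monoˡ-≤ t k≤j)) (ℕP.≤-reflexive (sym (ℕP.*-suc j t))))

  hypersimplexLat-formula : ∀ {k d} t → 1 ≤ k → k ≤ suc d →
    + (d !) * + hypersimplexLat k d t ≡ ∑ k (λ j → signedBinomial (suc d) j * rising d (- + j + + (k ∸ j) * + t))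
  hypersimplexLat-formula {k} {d} t 1≤k k≤1+d = begin
    + (d !) * + hypersimplexLat k d t
      ≡⟨ cong (λ n → + (d !) * + n) (hypersimplexLat≡sliceSize k d t) ⟩
    + (d !) * + sliceSize (suc d) t (+ (k ℕ.* t))
      ≡⟨ cong (+ (d !) *_) (sliceSize-closedForm (suc d) t (+ (k ℕ.* t))) ⟩
    + (d !) * signedBinomialSum (suc d) W
      ≡⟨ *-distribˡ-∑ (suc (suc d)) (+ (d !)) _ ⟩
    ∑ (suc (suc d)) term
      ≡⟨ ∑-truncate (suc (suc d)) term (ℕP.m≤n⇒m≤1+n k≤1+d) vanishes ⟩
    ∑ k term
      ≡⟨ ∑-cong k (λ j j<k → trans (swap (+ (d !)) (signedBinomial (suc d) j) (W j))
                                     (cong (signedBinomial (suc d) j *_) (rising-term j j<k))) ⟩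
    ∑ k (λ j → signedBinomial (suc d) j * rising d (- + j + + (k ∸ j) * + t)) ∎
    where
    open ≡-Reasoning
    W : ℕ → ℤ
    W j = weakCompositionsℤ (suc d) (+ (k ℕ.* t) - + (j ℕ.* suc t))
    term : ℕ → ℤ
    term j = + (d !) * (signedBinomial (suc d) j * W j)
    swap : ∀ a b c → a * (b * c) ≡ b * (a * c)
    swap = solve-∀
    vanishes : ∀ j → k ≤ j → term j ≡ 0ℤ
    vanishes j k≤j = begin
      + (d !) * (signedBinomial (suc d) j * W j)
        ≡⟨ cong (λ w → + (d !) * (signedBinomial (suc d) j * w)) (weakCompositionsℤ-negative (suc d) (shiftedTarget-negative t 1≤k k≤j)) ⟩
      + (d !) * (signedBinomial (suc d) j * 0ℤ)
        ≡⟨ cong (+ (d !) *_) (ℤP.*-zeroʳ (signedBinomial (suc d) j)) ⟩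
      + (d !) * 0ℤ
        ≡⟨ ℤP.*-zeroʳ (+ (d !)) ⟩
      0ℤ ∎
    rising-term : ∀ j → j ℕ.< k → + (d !) * W j ≡ rising d (- + j + + (k ∸ j) * + t)
    rising-term j j<k = begin
      + (d !) * W j
        ≡⟨ cong (λ y → + (d !) * weakCompositionsℤ (suc d) y) (shiftedTarget t (ℕP.<⇒≤ j<k)) ⟩
      + (d !) * weakCompositionsℤ (suc d) (- + j + + (k ∸ j) * + t)
        ≡⟨ sym (rising-weakCompositionsℤ d _ (shiftedTarget-bound t j<k k≤1+d)) ⟩
      rising d (- + j + + (k ∸ j) * + t) ∎

module LinearCoefficient where

  open import Data.Nat as ℕ using (zero; suc; _!; _∸_; _/_; s≤s; z≤n; NonZero; >-nonZero)
  import Data.Nat.Properties as ℕP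
  open import Data.Nat.DivMod using (m/n*n≡m; m*[n/m]≡n)
  open import Data.Nat.Combinatorics using (_C_; nCk≡n!/k![n-k]!; k![n∸k]!∣n!; [n-k]*[n-k-1]!≡[n-k]!)
  import Data.Nat.Tactic.RingSolver as ℕ-Solver
  open import Data.Integer as ℤ using (ℤ; +_; -[1+_]; 0ℤ; 1ℤ; -1ℤ; _+_; _-_; _*_; -_; _^_; +≤+; +<+)
  import Data.Integer.Properties as ℤP
  open import Data.Integer.Tactic.RingSolver using (solve-∀)
  open import Data.Product using (_,_)
  open import Relation.Nullary using (yes; no)
  open import Relation.Binary.PropositionalEquality
  open IntegerSums
  open RisingFactorial

  nCk*[k!*[n∸k]!]≡n! : ∀ {n k} → k ≤ n → (n C k) ℕ.* (k ! ℕ.* (n ∸ k) !) ≡ n !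
  nCk*[k!*[n∸k]!]≡n! {n} {k} k≤n = trans (cong (ℕ._* (k ! ℕ.* (n ∸ k) !)) (nCk≡n!/k![n-k]! k≤n))
                                         (m/n*n≡m {{ℕP._!*_!≢0 k (n ∸ k)}} (k![n∸k]!∣n! k≤n))

  rootWeight : ℕ → ℕ → ℕ
  rootWeight d J = (suc d C suc J) ℕ.* (J ! ℕ.* (d ∸ suc J) !)

  rootWeight*[1+J]*[d∸J]≡[1+d]! : ∀ {d J} → J ℕ.< d → rootWeight d J ℕ.* (suc J ℕ.* (d ∸ J)) ≡ suc d !
  rootWeight*[1+J]*[d∸J]≡[1+d]! {d} {J} J<d = begin
    (suc d C suc J) ℕ.* (J ! ℕ.* (d ∸ suc J) !) ℕ.* (suc J ℕ.* (d ∸ J))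
      ≡⟨ regroup (suc d C suc J) (J !) ((d ∸ suc J) !) (suc J) (d ∸ J) ⟩
    (suc d C suc J) ℕ.* (suc J ! ℕ.* ((d ∸ J) ℕ.* (d ∸ suc J) !))
      ≡⟨ cong (λ x → (suc d C suc J) ℕ.* (suc J ! ℕ.* x)) ([n-k]*[n-k-1]!≡[n-k]! (s≤s J<d)) ⟩
    (suc d C suc J) ℕ.* (suc J ! ℕ.* (d ∸ J) !)
      ≡⟨ nCk*[k!*[n∸k]!]≡n! (s≤s (ℕP.<⇒≤ J<d)) ⟩
    suc d ! ∎
    where
    open ≡-Reasoning
    regroup : ∀ c a r s D → c ℕ.* (a ℕ.* r) ℕ.* (s ℕ.* D) ≡ c ℕ.* (s ℕ.* a ℕ.* (D ℕ.* r))
    regroup = ℕ-Solver.solve-∀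

  [m∸n]*[n+o]≤m*o : ∀ {m} n o → m ≤ n ℕ.+ o → (m ∸ n) ℕ.* (n ℕ.+ o) ≤ m ℕ.* o
  [m∸n]*[n+o]≤m*o {m} n o m≤n+o with n ℕ.≤? m
  ... | no  n≰m rewrite ℕP.m≤n⇒m∸n≡0 (ℕP.<⇒≤ (ℕP.≰⇒> n≰m)) = z≤n
  ... | yes n≤m with ℕP.m≤n⇒∃[o]m+o≡n n≤m
  ...   | e , refl = begin
    (n ℕ.+ e ∸ n) ℕ.* (n ℕ.+ o)   ≡⟨ cong (ℕ._* (n ℕ.+ o)) (ℕP.m+n∸m≡n n e) ⟩
    e ℕ.* (n ℕ.+ o)               ≡⟨ ℕP.*-distribˡ-+ e n o ⟩
    e ℕ.* n ℕ.+ e ℕ.* o           ≤⟨ ℕP.+-monoˡ-≤ (e ℕ.* o) (ℕP.*-monoˡ-≤ n e≤o) ⟩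
    o ℕ.* n ℕ.+ e ℕ.* o           ≡⟨ regroup n e o ⟩
    (n ℕ.+ e) ℕ.* o               ∎
    where
    open ℕP.≤-Reasoning
    e≤o : e ≤ o
    e≤o = ℕP.+-cancelˡ-≤ n e o m≤n+o
    regroup : ∀ n e o → o ℕ.* n ℕ.+ e ℕ.* o ≡ (n ℕ.+ e) ℕ.* o
    regroup = ℕ-Solver.solve-∀

  rootTerm≤ : ∀ {k d J} → J ℕ.< d → k ≤ suc d → (k ∸ suc J) ℕ.* rootWeight d J ≤ k ℕ.* (d ! / suc J)
  rootTerm≤ {k} {d} {J} J<d k≤1+d = ℕP.*-cancelʳ-≤ _ _ (suc J ℕ.* D) {{ℕP.m*n≢0 (suc J) D {{_}} {{D≢0}}}} (begin
    (k ∸ suc J) ℕ.* W ℕ.* (suc J ℕ.* D)       ≡⟨ ℕP.*-assoc (k ∸ suc J) W (suc J ℕ.* D) ⟩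
    (k ∸ suc J) ℕ.* (W ℕ.* (suc J ℕ.* D))     ≡⟨ cong ((k ∸ suc J) ℕ.*_) (rootWeight*[1+J]*[d∸J]≡[1+d]! J<d) ⟩
    (k ∸ suc J) ℕ.* (suc d ℕ.* d !)           ≡⟨ sym (ℕP.*-assoc (k ∸ suc J) (suc d) (d !)) ⟩
    (k ∸ suc J) ℕ.* suc d ℕ.* d !             ≡⟨ cong (λ x → (k ∸ suc J) ℕ.* x ℕ.* d !) 1+d≡1+J+D ⟩
    (k ∸ suc J) ℕ.* (suc J ℕ.+ D) ℕ.* d !     ≤⟨ ℕP.*-monoˡ-≤ (d !) ([m∸n]*[n+o]≤m*o (suc J) D k≤1+J+D) ⟩
    k ℕ.* D ℕ.* d !                           ≡⟨ cong (k ℕ.* D ℕ.*_) (sym (m*[n/m]≡n (1+J∣d! J<d))) ⟩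
    k ℕ.* D ℕ.* (suc J ℕ.* (d ! / suc J))     ≡⟨ regroup k D (suc J) (d ! / suc J) ⟩
    k ℕ.* (d ! / suc J) ℕ.* (suc J ℕ.* D)     ∎)
    where
    open ℕP.≤-Reasoning
    D W : ℕ
    D = d ∸ J
    W = rootWeight d J
    D≢0 : NonZero D
    D≢0 = >-nonZero (ℕP.m<n⇒0<n∸m J<d)
    1+d≡1+J+D : suc d ≡ suc J ℕ.+ D
    1+d≡1+J+D = cong suc (sym (ℕP.m+[n∸m]≡n (ℕP.<⇒≤ J<d)))
    k≤1+J+D : k ≤ suc J ℕ.+ D
    k≤1+J+D = ℕP.≤-trans k≤1+d (ℕP.≤-reflexive 1+d≡1+J+D)
    regroup : ∀ k D s h → k ℕ.* D ℕ.* (s ℕ.* h) ≡ k ℕ.* h ℕ.* (s ℕ.* D)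
    regroup = ℕ-Solver.solve-∀

  linearTerm : ℕ → ℕ → ℕ → ℤ
  linearTerm k d j = signedBinomial (suc d) j * (+ (k ∸ j) * rising′ d (- + j))

  linearTerm-vanishes : ∀ {k j} d → k ≤ j → linearTerm k d j ≡ 0ℤ
  linearTerm-vanishes {k} {j} d k≤j =
    trans (cong (λ e → signedBinomial (suc d) j * (+ e * rising′ d (- + j))) (ℕP.m≤n⇒m∸n≡0 k≤j))
          (ℤP.*-zeroʳ (signedBinomial (suc d) j))

  linearTerm-zero : ∀ k d → linearTerm k d 0 ≡ + k * rising′ d 0ℤ
  linearTerm-zero k d = ℤP.*-identityˡ _

  -1^j*-1^j≡1 : ∀ j → -1ℤ ^ j * -1ℤ ^ j ≡ 1ℤ
  -1^j*-1^j≡1 zero    = refl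
  -1^j*-1^j≡1 (suc j) = trans (square (-1ℤ ^ j)) (-1^j*-1^j≡1 j)
    where
    square : ∀ s → -1ℤ * s * (-1ℤ * s) ≡ s * s
    square = solve-∀

  linearTerm-root : ∀ k {d J} → J ℕ.< d → linearTerm k d (suc J) ≡ - + ((k ∸ suc J) ℕ.* rootWeight d J)
  linearTerm-root k {d} {J} J<d = begin
    -1ℤ * s * + b * (+ e * rising′ d -[1+ J ])   ≡⟨ cong (λ x → -1ℤ * s * + b * (+ e * x)) (rising′-root J<d) ⟩
    -1ℤ * s * + b * (+ e * (s * + f))           ≡⟨ regroup s (+ b) (+ e) (+ f) ⟩
    - (s * s * (+ e * (+ b * + f)))             ≡⟨ cong (λ x → - (x * (+ e * (+ b * + f)))) (-1^j*-1^j≡1 J) ⟩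
    - (1ℤ * (+ e * (+ b * + f)))                ≡⟨ cong -_ (ℤP.*-identityˡ _) ⟩
    - (+ e * (+ b * + f))                       ≡⟨ cong (λ x → - (+ e * x)) (sym (ℤP.pos-* b f)) ⟩
    - (+ e * + (b ℕ.* f))                       ≡⟨ cong -_ (sym (ℤP.pos-* e (b ℕ.* f))) ⟩
    - + (e ℕ.* (b ℕ.* f))                       ∎
    where
    open ≡-Reasoning
    s : ℤ
    s = -1ℤ ^ J
    e b f : ℕ
    e = k ∸ suc J
    b = suc d C suc J
    f = J ! ℕ.* (d ∸ suc J) !
    regroup : ∀ s b e f → -1ℤ * s * b * (e * (s * f)) ≡ - (s * s * (e * (b * f)))
    regroup = solve-∀

  ∑-linearTerm : ∀ {k d} → k ≤ suc d →
    ∑ k (linearTerm k d) ≡ ∑ d (λ J → + (k ℕ.* (d ! / suc J))) - ∑ d (λ J → + ((k ∸ suc J) ℕ.* rootWeight d J))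
  ∑-linearTerm {k} {d} k≤1+d = begin
    ∑ k (linearTerm k d)
      ≡⟨ sym (∑-truncate (suc d) (linearTerm k d) k≤1+d (λ j → linearTerm-vanishes d)) ⟩
    ∑ (suc d) (linearTerm k d)
      ≡⟨ ∑-head d (linearTerm k d) ⟩
    linearTerm k d 0 + ∑ d (λ J → linearTerm k d (suc J))
      ≡⟨ cong₂ _+_ (linearTerm-zero k d) (∑-cong d (λ J → linearTerm-root k)) ⟩
    + k * rising′ d 0ℤ + ∑ d (λ J → - + ((k ∸ suc J) ℕ.* rootWeight d J))
      ≡⟨ cong₂ _+_ harmonic (∑-neg d _) ⟩
    ∑ d (λ J → + (k ℕ.* (d ! / suc J))) - ∑ d (λ J → + ((k ∸ suc J) ℕ.* rootWeight d J)) ∎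
    where
    open ≡-Reasoning
    harmonic : + k * rising′ d 0ℤ ≡ ∑ d (λ J → + (k ℕ.* (d ! / suc J)))
    harmonic = trans (cong (+ k *_) (rising′-zero d))
                     (trans (*-distribˡ-∑ d (+ k) _) (∑-cong d (λ J _ → sym (ℤP.pos-* k (d ! / suc J)))))

  ∑-linearTerm-pos : ∀ {k d} → 1 ≤ k → k ≤ d → 0ℤ ℤ.< ∑ k (linearTerm k d)
  ∑-linearTerm-pos {suc k′} {suc d′} _ k≤d = begin-strict
    0ℤ      ≡⟨ sym (ℤP.+-inverseʳ B) ⟩
    B - B   <⟨ ℤP.+-monoˡ-< (- B) B<A ⟩
    A - B   ≡⟨ sym (∑-linearTerm (ℕP.m≤n⇒m≤1+n k≤d)) ⟩
    ∑ k (linearTerm k d) ∎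
    where
    open ℤP.≤-Reasoning
    k d : ℕ
    k = suc k′
    d = suc d′
    A B : ℤ
    A = ∑ d (λ J → + (k ℕ.* (d ! / suc J)))
    B = ∑ d (λ J → + ((k ∸ suc J) ℕ.* rootWeight d J))
    unmatched : (k ∸ d) ℕ.* rootWeight d d′ ℕ.< k ℕ.* (d ! / d)
    unmatched rewrite ℕP.m≤n⇒m∸n≡0 k≤d | [1+n]!/[1+n]≡n! d′ = ℕP.*-mono-≤ (s≤s (z≤n {k′})) (ℕP.1≤n! d′)
    B<A : B ℤ.< A
    B<A = ℤP.+-mono-≤-< (∑-mono-≤ d′ (λ J J<d′ → +≤+ (rootTerm≤ (ℕP.m<n⇒m<1+n J<d′) (ℕP.m≤n⇒m≤1+n k≤d))))
                        (+<+ unmatched)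

module IntegerPolynomials where

  open import Data.Nat as ℕ using (zero; suc)
  open import Data.Integer as ℤ using (ℤ; 0ℤ; 1ℤ; _+_; _*_)
  import Data.Integer.Properties as ℤP
  open import Data.Integer.Tactic.RingSolver using (solve-∀)
  open import Data.List using (List; []; _∷_; map)
  open import Relation.Binary.PropositionalEquality
  open IntegerSums using (∑)
  open RisingFactorial using (rising; rising′)

  Polyℤ : Set
  Polyℤ = List ℤ

  evalℤ : Polyℤ → ℤ → ℤ
  evalℤ []       x = 0ℤ
  evalℤ (c ∷ cs) x = c + x * evalℤ cs x

  coeffℤ : Polyℤ → ℕ → ℤ
  coeffℤ []       i       = 0ℤ
  coeffℤ (c ∷ cs) zero    = c
  coeffℤ (c ∷ cs) (suc i) = coeffℤ cs i

  infixl 6 _+ₚ_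
  infixl 7 _·ₚ_

  _+ₚ_ : Polyℤ → Polyℤ → Polyℤ
  []       +ₚ q        = q
  (a ∷ p)  +ₚ []       = a ∷ p
  (a ∷ p)  +ₚ (b ∷ q)  = (a + b) ∷ (p +ₚ q)

  _·ₚ_ : ℤ → Polyℤ → Polyℤ
  c ·ₚ p = map (c *_) p

  ∑ₚ : ℕ → (ℕ → Polyℤ) → Polyℤ
  ∑ₚ zero    f = []
  ∑ₚ (suc n) f = ∑ₚ n f +ₚ f n

  eval-+ₚ : ∀ p q x → evalℤ (p +ₚ q) x ≡ evalℤ p x + evalℤ q x
  eval-+ₚ []      q       x = sym (ℤP.+-identityˡ _)
  eval-+ₚ (a ∷ p) []      x = sym (ℤP.+-identityʳ _)
  eval-+ₚ (a ∷ p) (b ∷ q) x =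
    trans (cong (λ e → a + b + x * e) (eval-+ₚ p q x)) (interchange a b x (evalℤ p x) (evalℤ q x))
    where
    interchange : ∀ a b x e f → a + b + x * (e + f) ≡ a + x * e + (b + x * f)
    interchange = solve-∀

  eval-·ₚ : ∀ c p x → evalℤ (c ·ₚ p) x ≡ c * evalℤ p x
  eval-·ₚ c []      x = sym (ℤP.*-zeroʳ c)
  eval-·ₚ c (a ∷ p) x = trans (cong (λ e → c * a + x * e) (eval-·ₚ c p x)) (factor c a x (evalℤ p x))
    where
    factor : ∀ c a x e → c * a + x * (c * e) ≡ c * (a + x * e)
    factor = solve-∀

  eval-∑ₚ : ∀ n f x → evalℤ (∑ₚ n f) x ≡ ∑ n (λ j → evalℤ (f j) x)
  eval-∑ₚ zero    f x = refl
  eval-∑ₚ (suc n) f x = trans (eval-+ₚ (∑ₚ n f) (f n) x) (cong (_+ evalℤ (f n) x) (eval-∑ₚ n f x))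

  coeff-+ₚ : ∀ p q i → coeffℤ (p +ₚ q) i ≡ coeffℤ p i + coeffℤ q i
  coeff-+ₚ []      q       i       = sym (ℤP.+-identityˡ _)
  coeff-+ₚ (a ∷ p) []      i       = sym (ℤP.+-identityʳ _)
  coeff-+ₚ (a ∷ p) (b ∷ q) zero    = refl
  coeff-+ₚ (a ∷ p) (b ∷ q) (suc i) = coeff-+ₚ p q i

  coeff-·ₚ : ∀ c p i → coeffℤ (c ·ₚ p) i ≡ c * coeffℤ p i
  coeff-·ₚ c []      i       = sym (ℤP.*-zeroʳ c)
  coeff-·ₚ c (a ∷ p) zero    = refl
  coeff-·ₚ c (a ∷ p) (suc i) = coeff-·ₚ c p i

  coeff-∑ₚ : ∀ n f i → coeffℤ (∑ₚ n f) i ≡ ∑ n (λ j → coeffℤ (f j) i)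
  coeff-∑ₚ zero    f i = refl
  coeff-∑ₚ (suc n) f i = trans (coeff-+ₚ (∑ₚ n f) (f n) i) (cong (_+ coeffℤ (f n) i) (coeff-∑ₚ n f i))

  mulLinear : Polyℤ → ℤ → ℤ → Polyℤ
  mulLinear p a b = a ·ₚ p +ₚ (0ℤ ∷ b ·ₚ p)

  eval-mulLinear : ∀ p a b x → evalℤ (mulLinear p a b) x ≡ (a + b * x) * evalℤ p x
  eval-mulLinear p a b x = begin
    evalℤ (a ·ₚ p +ₚ (0ℤ ∷ b ·ₚ p)) x              ≡⟨ eval-+ₚ (a ·ₚ p) (0ℤ ∷ b ·ₚ p) x ⟩
    evalℤ (a ·ₚ p) x + (0ℤ + x * evalℤ (b ·ₚ p) x)  ≡⟨ cong₂ (λ u v → u + (0ℤ + x * v)) (eval-·ₚ a p x) (eval-·ₚ b p x) ⟩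
    a * e + (0ℤ + x * (b * e))                      ≡⟨ collect a b x e ⟩
    (a + b * x) * e                                 ∎
    where
    open ≡-Reasoning
    e = evalℤ p x
    collect : ∀ a b x e → a * e + (0ℤ + x * (b * e)) ≡ (a + b * x) * e
    collect = solve-∀

  coeff₀-mulLinear : ∀ p a b → coeffℤ (mulLinear p a b) 0 ≡ a * coeffℤ p 0
  coeff₀-mulLinear p a b =
    trans (coeff-+ₚ (a ·ₚ p) (0ℤ ∷ b ·ₚ p) 0) (trans (ℤP.+-identityʳ _) (coeff-·ₚ a p 0))

  coeff₁-mulLinear : ∀ p a b → coeffℤ (mulLinear p a b) 1 ≡ a * coeffℤ p 1 + b * coeffℤ p 0
  coeff₁-mulLinear p a b =
    trans (coeff-+ₚ (a ·ₚ p) (0ℤ ∷ b ·ₚ p) 1) (cong₂ _+_ (coeff-·ₚ a p 1) (coeff-·ₚ b p 0))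

  risingPoly : ℕ → ℤ → ℤ → Polyℤ
  risingPoly zero    a b = 1ℤ ∷ []
  risingPoly (suc d) a b = mulLinear (risingPoly d (1ℤ + a) b) (1ℤ + a) b

  eval-risingPoly : ∀ d a b x → evalℤ (risingPoly d a b) x ≡ rising d (a + b * x)
  eval-risingPoly zero    a b x = base x
    where
    base : ∀ x → 1ℤ + x * 0ℤ ≡ 1ℤ
    base = solve-∀
  eval-risingPoly (suc d) a b x = begin
    evalℤ (mulLinear (risingPoly d (1ℤ + a) b) (1ℤ + a) b) x
      ≡⟨ eval-mulLinear (risingPoly d (1ℤ + a) b) (1ℤ + a) b x ⟩
    (1ℤ + a + b * x) * evalℤ (risingPoly d (1ℤ + a) b) x
      ≡⟨ cong ((1ℤ + a + b * x) *_) (eval-risingPoly d (1ℤ + a) b x) ⟩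
    (1ℤ + a + b * x) * rising d (1ℤ + a + b * x)
      ≡⟨ cong (λ y → y * rising d y) (ℤP.+-assoc 1ℤ a (b * x)) ⟩
    rising (suc d) (a + b * x) ∎
    where open ≡-Reasoning

  coeff₀-risingPoly : ∀ d a b → coeffℤ (risingPoly d a b) 0 ≡ rising d a
  coeff₀-risingPoly zero    a b = refl
  coeff₀-risingPoly (suc d) a b =
    trans (coeff₀-mulLinear (risingPoly d (1ℤ + a) b) (1ℤ + a) b)
          (cong ((1ℤ + a) *_) (coeff₀-risingPoly d (1ℤ + a) b))

  coeff₁-risingPoly : ∀ d a b → coeffℤ (risingPoly d a b) 1 ≡ b * rising′ d a
  coeff₁-risingPoly zero    a b = sym (ℤP.*-zeroʳ b)
  coeff₁-risingPoly (suc d) a b = begin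
    coeffℤ (mulLinear P (1ℤ + a) b) 1
      ≡⟨ coeff₁-mulLinear P (1ℤ + a) b ⟩
    (1ℤ + a) * coeffℤ P 1 + b * coeffℤ P 0
      ≡⟨ cong₂ (λ u v → (1ℤ + a) * u + b * v) (coeff₁-risingPoly d (1ℤ + a) b) (coeff₀-risingPoly d (1ℤ + a) b) ⟩
    (1ℤ + a) * (b * rising′ d (1ℤ + a)) + b * rising d (1ℤ + a)
      ≡⟨ product-rule (1ℤ + a) b (rising′ d (1ℤ + a)) (rising d (1ℤ + a)) ⟩
    b * rising′ (suc d) a ∎
    where
    open ≡-Reasoning
    P = risingPoly d (1ℤ + a) b
    product-rule : ∀ α b r′ r → α * (b * r′) + b * r ≡ b * (r + α * r′)
    product-rule = solve-∀

module RationalPolynomials where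

  open import Data.Nat as ℕ using (zero; suc; s≤s)
  import Data.Nat.Properties as ℕP
  open import Data.Integer as ℤ using (ℤ; +_)
  open import Data.Integer.Tactic.RingSolver using (solve-∀)
  open import Data.Rational using (ℚ; 1ℚ; _+_; _-_; _*_; -_; _/_; 1/_; NonZero; Positive)
  import Data.Rational as ℚ
  import Data.Rational.Properties as ℚP
  open import Data.Rational.Unnormalised using (mkℚᵘ; *≡*)
  import Data.Rational.Unnormalised as ℚᵘ
  import Data.Rational.Unnormalised.Properties as ℚᵘP
  open import Data.Rational.Solver using (module +-*-Solver)
  open import Data.List using ([]; _∷_; length)
  open import Data.Product using (_,_)
  open import Relation.Binary.PropositionalEquality
  open +-*-Solver using (solve; _:=_; con; _:+_; _:*_; _:-_; :-_)

  -- `fromℕ n` is definitionally `fromℤ (+ n)`.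
  fromℤ : ℤ → ℚ
  fromℤ i = i / 1

  fromℤ-homo-+ : ∀ i j → fromℤ (i ℤ.+ j) ≡ fromℤ i + fromℤ j
  fromℤ-homo-+ i j = ℚP.toℚᵘ-injective (begin
    ℚ.toℚᵘ (fromℤ (i ℤ.+ j))                 ≈⟨ ℚP.toℚᵘ-fromℚᵘ (mkℚᵘ (i ℤ.+ j) 0) ⟩
    mkℚᵘ (i ℤ.+ j) 0                          ≈⟨ *≡* (over-one i j) ⟩
    mkℚᵘ i 0 ℚᵘ.+ mkℚᵘ j 0                   ≈⟨ ℚᵘP.+-cong (ℚP.toℚᵘ-fromℚᵘ (mkℚᵘ i 0)) (ℚP.toℚᵘ-fromℚᵘ (mkℚᵘ j 0)) ⟨
    ℚ.toℚᵘ (fromℤ i) ℚᵘ.+ ℚ.toℚᵘ (fromℤ j)   ≈⟨ ℚP.toℚᵘ-homo-+ (fromℤ i) (fromℤ j) ⟨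
    ℚ.toℚᵘ (fromℤ i + fromℤ j)               ∎)
    where
    open ℚᵘP.≃-Reasoning
    over-one : ∀ i j → (i ℤ.+ j) ℤ.* ℤ.1ℤ ≡ (i ℤ.* ℤ.1ℤ ℤ.+ j ℤ.* ℤ.1ℤ) ℤ.* ℤ.1ℤ
    over-one = solve-∀

  fromℤ-homo-* : ∀ i j → fromℤ (i ℤ.* j) ≡ fromℤ i * fromℤ j
  fromℤ-homo-* i j = ℚP.toℚᵘ-injective (begin
    ℚ.toℚᵘ (fromℤ (i ℤ.* j))                 ≈⟨ ℚP.toℚᵘ-fromℚᵘ (mkℚᵘ (i ℤ.* j) 0) ⟩
    mkℚᵘ (i ℤ.* j) 0                          ≈⟨ ℚᵘP.*-cong (ℚP.toℚᵘ-fromℚᵘ (mkℚᵘ i 0)) (ℚP.toℚᵘ-fromℚᵘ (mkℚᵘ j 0)) ⟨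
    ℚ.toℚᵘ (fromℤ i) ℚᵘ.* ℚ.toℚᵘ (fromℤ j)   ≈⟨ ℚP.toℚᵘ-homo-* (fromℤ i) (fromℤ j) ⟨
    ℚ.toℚᵘ (fromℤ i * fromℤ j)               ∎)
    where open ℚᵘP.≃-Reasoning

  fromℤ-pos : ∀ i → ℤ.Positive i → Positive (fromℤ i)
  fromℤ-pos (+ suc n) _ = ℚP.normalize-pos (suc n) 1

  fromℕ[m+n]-fromℕ[m]≡fromℕ[n] : ∀ m n → fromℕ (m ℕ.+ n) - fromℕ m ≡ fromℕ n
  fromℕ[m+n]-fromℕ[m]≡fromℕ[n] m n =
    trans (cong (_- fromℕ m) (fromℤ-homo-+ (+ m) (+ n))) (cancel (fromℕ m) (fromℕ n))
    where
    cancel : ∀ a b → a + b - a ≡ b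
    cancel = solve 2 (λ a b → a :+ b :- a := b) refl

  *-cancelˡ-≡0 : ∀ p q .{{_ : NonZero p}} → p * q ≡ 0ℚ → q ≡ 0ℚ
  *-cancelˡ-≡0 p q pq≡0 = begin
    q                   ≡⟨ sym (ℚP.*-identityˡ q) ⟩
    1ℚ * q              ≡⟨ cong (_* q) (sym (ℚP.*-inverseˡ p)) ⟩
    1/ p * p * q        ≡⟨ ℚP.*-assoc (1/ p) p q ⟩
    1/ p * (p * q)      ≡⟨ cong (1/ p *_) pq≡0 ⟩
    1/ p * 0ℚ           ≡⟨ ℚP.*-zeroʳ (1/ p) ⟩
    0ℚ                  ∎
    where open ≡-Reasoning

  _-ₚ_ : Poly → Poly → Poly
  []       -ₚ []       = []
  []       -ₚ (b ∷ q)  = (- b) ∷ ([] -ₚ q)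
  (a ∷ p)  -ₚ []       = a ∷ (p -ₚ [])
  (a ∷ p)  -ₚ (b ∷ q)  = (a - b) ∷ (p -ₚ q)

  eval--ₚ : ∀ p q x → eval (p -ₚ q) x ≡ eval p x - eval q x
  eval--ₚ []      []      x = refl
  eval--ₚ []      (b ∷ q) x = trans (cong (λ e → - b + x * e) (eval--ₚ [] q x)) (law b x (eval q x))
    where
    law : ∀ b x e → - b + x * (0ℚ - e) ≡ 0ℚ - (b + x * e)
    law = solve 3 (λ b x e → :- b :+ x :* (con 0ℚ :- e) := con 0ℚ :- (b :+ x :* e)) refl
  eval--ₚ (a ∷ p) []      x = trans (cong (λ e → a + x * e) (eval--ₚ p [] x)) (law a x (eval p x))
    where
    law : ∀ a x e → a + x * (e - 0ℚ) ≡ a + x * e - 0ℚ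
    law = solve 3 (λ a x e → a :+ x :* (e :- con 0ℚ) := a :+ x :* e :- con 0ℚ) refl
  eval--ₚ (a ∷ p) (b ∷ q) x = trans (cong (λ e → a - b + x * e) (eval--ₚ p q x)) (law a b x (eval p x) (eval q x))
    where
    law : ∀ a b x e f → a - b + x * (e - f) ≡ a + x * e - (b + x * f)
    law = solve 5 (λ a b x e f → a :- b :+ x :* (e :- f) := a :+ x :* e :- (b :+ x :* f)) refl

  coeff--ₚ : ∀ p q i → coeff (p -ₚ q) i ≡ coeff p i - coeff q i
  coeff--ₚ []      []      i       = refl
  coeff--ₚ []      (b ∷ q) zero    = sym (ℚP.+-identityˡ (- b))
  coeff--ₚ []      (b ∷ q) (suc i) = coeff--ₚ [] q i
  coeff--ₚ (a ∷ p) []      zero    = sym (ℚP.+-identityʳ a)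
  coeff--ₚ (a ∷ p) []      (suc i) = coeff--ₚ p [] i
  coeff--ₚ (a ∷ p) (b ∷ q) zero    = refl
  coeff--ₚ (a ∷ p) (b ∷ q) (suc i) = coeff--ₚ p q i

  remainder : ℚ → ℚ → Poly → ℚ
  remainder a c []        = c
  remainder a c (c′ ∷ cs) = c + a * remainder a c′ cs

  quotient : ℚ → ℚ → Poly → Poly
  quotient a c []        = []
  quotient a c (c′ ∷ cs) = remainder a c′ cs ∷ quotient a c′ cs

  length-quotient : ∀ a c cs → length (quotient a c cs) ≡ length cs
  length-quotient a c []        = refl
  length-quotient a c (c′ ∷ cs) = cong suc (length-quotient a c′ cs)

  eval-division : ∀ a c cs x → eval (c ∷ cs) x ≡ (x - a) * eval (quotient a c cs) x + remainder a c cs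
  eval-division a c []        x = law c x a
    where
    law : ∀ c x a → c + x * 0ℚ ≡ (x - a) * 0ℚ + c
    law = solve 3 (λ c x a → c :+ x :* con 0ℚ := (x :- a) :* con 0ℚ :+ c) refl
  eval-division a c (c′ ∷ cs) x =
    trans (cong (λ e → c + x * e) (eval-division a c′ cs x))
          (law c x a (eval (quotient a c′ cs) x) (remainder a c′ cs))
    where
    law : ∀ c x a q r → c + x * ((x - a) * q + r) ≡ (x - a) * (r + x * q) + (c + a * r)
    law = solve 5 (λ c x a q r → c :+ x :* ((x :- a) :* q :+ r) := (x :- a) :* (r :+ x :* q) :+ (c :+ a :* r)) refl

  coeff-division : ∀ a c cs i →
    coeff (c ∷ cs) i ≡ coeff (remainder a c cs ∷ quotient a c cs) i - a * coeff (quotient a c cs) i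
  coeff-division a c []        zero    = law c a
    where
    law : ∀ c a → c ≡ c - a * 0ℚ
    law = solve 2 (λ c a → c := c :- a :* con 0ℚ) refl
  coeff-division a c []        (suc i) = law a
    where
    law : ∀ a → 0ℚ ≡ 0ℚ - a * 0ℚ
    law = solve 1 (λ a → con 0ℚ := con 0ℚ :- a :* con 0ℚ) refl
  coeff-division a c (c′ ∷ cs) zero    = law c a (remainder a c′ cs)
    where
    law : ∀ c a r → c ≡ c + a * r - a * r
    law = solve 3 (λ c a r → c := c :+ a :* r :- a :* r) refl
  coeff-division a c (c′ ∷ cs) (suc i) = coeff-division a c′ cs i

  remainder-root : ∀ a c cs → remainder a c cs ≡ eval (c ∷ cs) a
  remainder-root a c cs = trans (law a (eval (quotient a c cs) a) (remainder a c cs)) (sym (eval-division a c cs a))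
    where
    law : ∀ a e r → r ≡ (a - a) * e + r
    law = solve 3 (λ a e r → r := (a :- a) :* e :+ r) refl

  quotient-vanishes : ∀ {c cs} m → (∀ x → m ℕ.≤ x → eval (c ∷ cs) (fromℕ x) ≡ 0ℚ) →
    ∀ x → suc m ℕ.≤ x → eval (quotient (fromℕ m) c cs) (fromℕ x) ≡ 0ℚ
  quotient-vanishes {c} {cs} m vanish x m<x with ℕP.m≤n⇒∃[o]m+o≡n m<x
  ... | o , refl = *-cancelˡ-≡0 (fromℕ (suc o)) (eval q X) {{ℚP.pos⇒nonZero (fromℕ (suc o)) {{fromℤ-pos (+ suc o) _}}}} (begin
    fromℕ (suc o) * eval q X           ≡⟨ cong (_* eval q X) gap ⟩
    (X - a) * eval q X                 ≡⟨ sym (ℚP.+-identityʳ _) ⟩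
    (X - a) * eval q X + 0ℚ            ≡⟨ cong (λ z → (X - a) * eval q X + z) (sym r≡0) ⟩
    (X - a) * eval q X + r             ≡⟨ sym (eval-division a c cs X) ⟩
    eval (c ∷ cs) X                    ≡⟨ vanish (suc m ℕ.+ o) (ℕP.m≤n⇒m≤1+n (ℕP.m≤m+n m o)) ⟩
    0ℚ                                 ∎)
    where
    open ≡-Reasoning
    a X r : ℚ
    a = fromℕ m
    X = fromℕ (suc m ℕ.+ o)
    r = remainder a c cs
    q : Poly
    q = quotient a c cs
    r≡0 : r ≡ 0ℚ
    r≡0 = trans (remainder-root a c cs) (vanish m ℕP.≤-refl)
    gap : fromℕ (suc o) ≡ X - a
    gap = trans (sym (fromℕ[m+n]-fromℕ[m]≡fromℕ[n] m (suc o))) (cong (λ n → fromℕ n - a) (ℕP.+-suc m o))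

  -- Divide by X − m: the remainder is the value at m, and the quotient, one shorter, vanishes
  -- beyond m.
  eventually-zero⇒coeff≡0 : ∀ n P → length P ℕ.≤ n → ∀ m →
    (∀ x → m ℕ.≤ x → eval P (fromℕ x) ≡ 0ℚ) → ∀ i → coeff P i ≡ 0ℚ
  eventually-zero⇒coeff≡0 n       []       _         m vanish i = refl
  eventually-zero⇒coeff≡0 (suc n) (c ∷ cs) (s≤s len) m vanish i = begin
    coeff (c ∷ cs) i                  ≡⟨ coeff-division a c cs i ⟩
    coeff (r ∷ q) i - a * coeff q i   ≡⟨ cong₂ (λ u v → u - a * v) (all-zero i) (q-zero i) ⟩
    0ℚ - a * 0ℚ                       ≡⟨ law a ⟩
    0ℚ                                ∎
    where
    open ≡-Reasoning
    a r : ℚ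
    a = fromℕ m
    r = remainder a c cs
    q : Poly
    q = quotient a c cs
    law : ∀ a → 0ℚ - a * 0ℚ ≡ 0ℚ
    law = solve 1 (λ a → con 0ℚ :- a :* con 0ℚ := con 0ℚ) refl
    q-zero : ∀ i → coeff q i ≡ 0ℚ
    q-zero = eventually-zero⇒coeff≡0 n q (subst (ℕ._≤ n) (sym (length-quotient a c cs)) len) (suc m)
                                      (quotient-vanishes {c} {cs} m vanish)
    all-zero : ∀ i → coeff (r ∷ q) i ≡ 0ℚ
    all-zero zero    = trans (remainder-root a c cs) (vanish m ℕP.≤-refl)
    all-zero (suc i) = q-zero i

  coeff-unique : ∀ P Q → (∀ t → eval P (fromℕ t) ≡ eval Q (fromℕ t)) → ∀ i → coeff P i ≡ coeff Q i
  coeff-unique P Q agree i = begin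
    coeff P i                           ≡⟨ law (coeff P i) (coeff Q i) ⟩
    coeff P i - coeff Q i + coeff Q i   ≡⟨ cong (_+ coeff Q i) (sym (coeff--ₚ P Q i)) ⟩
    coeff (P -ₚ Q) i + coeff Q i        ≡⟨ cong (_+ coeff Q i) (eventually-zero⇒coeff≡0 _ (P -ₚ Q) ℕP.≤-refl 0 difference-vanishes i) ⟩
    0ℚ + coeff Q i                      ≡⟨ ℚP.+-identityˡ (coeff Q i) ⟩
    coeff Q i                           ∎
    where
    open ≡-Reasoning
    law : ∀ p q → p ≡ p - q + q
    law = solve 2 (λ p q → p := p :- q :+ q) refl
    difference-vanishes : ∀ t → 0 ℕ.≤ t → eval (P -ₚ Q) (fromℕ t) ≡ 0ℚ
    difference-vanishes t _ = trans (eval--ₚ P Q (fromℕ t))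
      (trans (cong (_- eval Q (fromℕ t)) (agree t)) (ℚP.+-inverseʳ (eval Q (fromℕ t))))

module EhrhartPolynomial where

  open import Data.Nat as ℕ using (zero; suc; _!; _∸_)
  import Data.Nat.Properties as ℕP
  open import Data.Integer as ℤ using (ℤ; +_)
  open import Data.Rational using (ℚ; 1ℚ; _+_; _*_; 1/_; NonZero; Positive)
  import Data.Rational.Properties as ℚP
  open import Data.Rational.Solver using (module +-*-Solver)
  open import Data.List using ([]; _∷_; map)
  open import Relation.Binary.PropositionalEquality
  open +-*-Solver using (solve; _:=_; _:+_; _:*_)
  open IntegerSums
  open RisingFactorial
  open HypersimplexCount
  open LinearCoefficient
  open IntegerPolynomials
  open RationalPolynomials

  fromℕ-!-pos : ∀ d → Positive (fromℕ (d !))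
  fromℕ-!-pos d = ℚP.normalize-pos (d !) 1 {{_}} {{d ℕP.!≢0}}

  1/d! : ℕ → ℚ
  1/d! d = (1/ fromℕ (d !)) {{ℚP.pos⇒nonZero (fromℕ (d !)) {{fromℕ-!-pos d}}}}

  scale : ℚ → Polyℤ → Poly
  scale r = map (λ c → fromℤ c * r)

  eval-scale : ∀ r p x → eval (scale r p) (fromℤ x) ≡ fromℤ (evalℤ p x) * r
  eval-scale r []       x = sym (ℚP.*-zeroˡ r)
  eval-scale r (c ∷ cs) x = begin
    fromℤ c * r + fromℤ x * eval (scale r cs) (fromℤ x)   ≡⟨ cong (λ e → fromℤ c * r + fromℤ x * e) (eval-scale r cs x) ⟩
    fromℤ c * r + fromℤ x * (fromℤ (evalℤ cs x) * r)     ≡⟨ factor (fromℤ c) (fromℤ x) (fromℤ (evalℤ cs x)) r ⟩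
    (fromℤ c + fromℤ x * fromℤ (evalℤ cs x)) * r         ≡⟨ cong (λ e → (fromℤ c + e) * r) (sym (fromℤ-homo-* x (evalℤ cs x))) ⟩
    (fromℤ c + fromℤ (x ℤ.* evalℤ cs x)) * r             ≡⟨ cong (_* r) (sym (fromℤ-homo-+ c (x ℤ.* evalℤ cs x))) ⟩
    fromℤ (c ℤ.+ x ℤ.* evalℤ cs x) * r                   ∎
    where
    open ≡-Reasoning
    factor : ∀ a x e r → a * r + x * (e * r) ≡ (a + x * e) * r
    factor = solve 4 (λ a x e r → a :* r :+ x :* (e :* r) := (a :+ x :* e) :* r) refl

  coeff-scale : ∀ r p i → coeff (scale r p) i ≡ fromℤ (coeffℤ p i) * r
  coeff-scale r []       i       = sym (ℚP.*-zeroˡ r)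
  coeff-scale r (c ∷ cs) zero    = refl
  coeff-scale r (c ∷ cs) (suc i) = coeff-scale r cs i

  ehrhartNumerator : ℕ → ℕ → Polyℤ
  ehrhartNumerator k d = ∑ₚ k (λ j → signedBinomial (suc d) j ·ₚ risingPoly d (ℤ.- + j) (+ (k ∸ j)))

  ehrhartPolynomial : ℕ → ℕ → Poly
  ehrhartPolynomial k d = scale (1/d! d) (ehrhartNumerator k d)

  evalℤ-ehrhartNumerator : ∀ k d x → evalℤ (ehrhartNumerator k d) x
                         ≡ ∑ k (λ j → signedBinomial (suc d) j ℤ.* rising d (ℤ.- + j ℤ.+ + (k ∸ j) ℤ.* x))
  evalℤ-ehrhartNumerator k d x = trans (eval-∑ₚ k _ x) (∑-cong k (λ j _ →
    trans (eval-·ₚ (signedBinomial (suc d) j) (risingPoly d (ℤ.- + j) (+ (k ∸ j))) x)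
          (cong (signedBinomial (suc d) j ℤ.*_) (eval-risingPoly d (ℤ.- + j) (+ (k ∸ j)) x))))

  coeffℤ-ehrhartNumerator : ∀ k d → coeffℤ (ehrhartNumerator k d) 1 ≡ ∑ k (linearTerm k d)
  coeffℤ-ehrhartNumerator k d = trans (coeff-∑ₚ k _ 1) (∑-cong k (λ j _ →
    trans (coeff-·ₚ (signedBinomial (suc d) j) (risingPoly d (ℤ.- + j) (+ (k ∸ j))) 1)
          (cong (signedBinomial (suc d) j ℤ.*_) (coeff₁-risingPoly d (ℤ.- + j) (+ (k ∸ j))))))

  ehrhartPolynomial-isEhrhart : ∀ {k d} → 1 ≤ k → k ≤ suc d → IsEhrhartPolyHypersimplex k d (ehrhartPolynomial k d)
  ehrhartPolynomial-isEhrhart {k} {d} 1≤k k≤1+d t = begin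
    eval (ehrhartPolynomial k d) (fromℕ t)                ≡⟨ eval-scale (1/d! d) (ehrhartNumerator k d) (+ t) ⟩
    fromℤ (evalℤ (ehrhartNumerator k d) (+ t)) * 1/d! d   ≡⟨ cong (λ n → fromℤ n * 1/d! d) count ⟩
    fromℤ (+ (d !) ℤ.* + L) * 1/d! d                      ≡⟨ cong (_* 1/d! d) (fromℤ-homo-* (+ (d !)) (+ L)) ⟩
    fromℕ (d !) * fromℕ L * 1/d! d                        ≡⟨ cong (_* 1/d! d) (ℚP.*-comm (fromℕ (d !)) (fromℕ L)) ⟩
    fromℕ L * fromℕ (d !) * 1/d! d                        ≡⟨ ℚP.*-assoc (fromℕ L) (fromℕ (d !)) (1/d! d) ⟩
    fromℕ L * (fromℕ (d !) * 1/d! d)                      ≡⟨ cong (fromℕ L *_) (ℚP.*-inverseʳ (fromℕ (d !)) {{d!≢0}}) ⟩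
    fromℕ L * 1ℚ                                          ≡⟨ ℚP.*-identityʳ (fromℕ L) ⟩
    fromℕ L                                               ∎
    where
    open ≡-Reasoning
    L : ℕ
    L = hypersimplexLat k d t
    d!≢0 : NonZero (fromℕ (d !))
    d!≢0 = ℚP.pos⇒nonZero (fromℕ (d !)) {{fromℕ-!-pos d}}
    count : evalℤ (ehrhartNumerator k d) (+ t) ≡ + (d !) ℤ.* + L
    count = trans (evalℤ-ehrhartNumerator k d (+ t)) (sym (hypersimplexLat-formula t 1≤k k≤1+d))

  ehrhartPolynomial-linearCoeff-pos : ∀ {k d} → 1 ≤ k → k ≤ d → 0ℚ < coeff (ehrhartPolynomial k d) 1
  ehrhartPolynomial-linearCoeff-pos {k} {d} 1≤k k≤d =
    subst (0ℚ <_) (sym (trans (coeff-scale (1/d! d) (ehrhartNumerator k d) 1)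
                              (cong (λ c → fromℤ c * 1/d! d) (coeffℤ-ehrhartNumerator k d))))
          (ℚP.positive⁻¹ _ {{ℚP.pos*pos⇒pos (fromℤ c₁) {{fromℤ-pos c₁ (ℤ.positive (∑-linearTerm-pos 1≤k k≤d))}}
                                            (1/d! d) {{ℚP.1/pos⇒pos (fromℕ (d !)) {{fromℕ-!-pos d}}}}}})
    where
    c₁ : ℤ
    c₁ = ∑ k (linearTerm k d)

open EhrhartPolynomial using (ehrhartPolynomial; ehrhartPolynomial-isEhrhart; ehrhartPolynomial-linearCoeff-pos)
open RationalPolynomials using (coeff-unique)
import Data.Nat.Properties as ℕP
open import Data.Product using (_,_)
open import Relation.Binary.PropositionalEquality using (sym; trans; subst)

lemma5p4 : (k d : ℕ) → 1 ≤ k → k ≤ d →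
    Σ Poly (IsEhrhartPolyHypersimplex k d)
    × ((P : Poly) → IsEhrhartPolyHypersimplex k d P → 0ℚ < coeff P 1)
lemma5p4 k d 1≤k k≤d = (ehrhartPolynomial k d , isEhrhart) , linearCoeff-pos
  where
  isEhrhart : IsEhrhartPolyHypersimplex k d (ehrhartPolynomial k d)
  isEhrhart = ehrhartPolynomial-isEhrhart 1≤k (ℕP.m≤n⇒m≤1+n k≤d)
  linearCoeff-pos : (P : Poly) → IsEhrhartPolyHypersimplex k d P → 0ℚ < coeff P 1
  linearCoeff-pos P isP = subst (0ℚ <_)
    (sym (coeff-unique P (ehrhartPolynomial k d) (λ t → trans (isP t) (sym (isEhrhart t))) 1))
    (ehrhartPolynomial-linearCoeff-pos 1≤k k≤d)
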